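{- Let $R$ be injective and univalent and let $p$ be a point such that $p\mathbin{;}R\subseteq R^+$. Then $R\mathbin{;}p=\mathsf{O}$ if and only if $R$ is acyclic, i.e. $R^+\subseteq\overline{\mathsf{I}}$.
   Context: $(B,\cup,\mathbin{;},\overline{\,\cdot\,},{}^{\top},{}^{*},\mathsf{I})$ is a Kleene relation algebra; all variables range over $B$. That is, $(B,\cup,\mathbin{;},\overline{\,\cdot\,},{}^{\top},\mathsf{I})$ is a relation algebra: $\cup$ is associative and commutative and $R=\overline{\overline{R}\cup\overline{S}}\cup\overline{\overline{R}\cup S}$; $\mathbin{;}$ is associative, $(R\cup S)\mathbin{;}T=R\mathbin{;}T\cup S\mathbin{;}T$, $R\mathbin{;}\mathsf{I}=R$; $(R^{\top})^{\top}=R$, $(R\cup S)^{\top}=R^{\top}\cup S^{\top}$, $(R\mathbin{;}S)^{\top}=S^{\top}\mathbin{;}R^{\top}$; $R^{\top}\mathbin{;}\overline{R\mathbin{;}S}\cup\overline{S}=\overline{S}$. The order is $R\subseteq S$ iff $R\cup S=S$; $R\cap S=\overline{\overline{R}\cup\overline{S}}$; $\mathsf{L}=R\cup\overline{R}$ is the greatest and $\mathsf{O}=R\cap\overline{R}$ the least element. The star satisfies $\mathsf{I}\cup R\mathbin{;}R^*\subseteq R^*$, $\mathsf{I}\cup R^*\mathbin{;}R\subseteq R^*$, $S\cup R\mathbin{;}Q\subseteq Q\Rightarrow R^*\mathbin{;}S\subseteq Q$, $S\cup Q\mathbin{;}R\subseteq Q\Rightarrow S\mathbin{;}R^*\subseteq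 Q$. Write $R^+=R\mathbin{;}R^*$. The algebra satisfies the Tarski rule ($R\neq\mathsf{O}$ iff $\mathsf{L}\mathbin{;}R\mathbin{;}\mathsf{L}=\mathsf{L}$) and the point axiom (for every $R\neq\mathsf{O}$ there are points $p,q$ with $p\mathbin{;}q^{\top}\subseteq R$). A point is an element $p$ with $p=p\mathbin{;}\mathsf{L}$, $p\mathbin{;}p^{\top}\subseteq\mathsf{I}$ and $\mathsf{I}\subseteq p^{\top}\mathbin{;}p$. Composition binds tighter than $\cup,\cap$; complement and converse bind tighter than composition. $R$ is univalent if $R^{\top}\mathbin{;}R\subseteq\mathsf{I}$ and injective if $R\mathbin{;}R^{\top}\subseteq\mathsf{I}$. -}

module Defs where

open import Level using (Level; suc)
open import Relation.Binary.PropositionalEquality using (_≡_)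
open import Relation.Nullary using (¬_)
open import Data.Product using (Σ; _×_)
open import Function.Bundles using (_⇔_)

record KleeneRelationAlgebra (ℓ : Level) : Set (suc ℓ) where
  infixr 6 _∪_
  infixr 7 _⨾_
  infix 4 _⊆_
  field
    B    : Set ℓ
    _∪_  : B → B → B
    _⨾_  : B → B → B
    ∁    : B → B
    _ᵀ   : B → B
    _*   : B → B
    I    : B

  _⊆_ : B → B → Set ℓ
  R ⊆ S = R ∪ S ≡ S

  _∩_ : B → B → B
  R ∩ S = ∁ (∁ R ∪ ∁ S)

  field
    ∪-assoc  : ∀ R S T → (R ∪ S) ∪ T ≡ R ∪ (S ∪ T)
    ∪-comm   : ∀ R S → R ∪ S ≡ S ∪ R
    huntington : ∀ R S → R ≡ ∁ (∁ R ∪ ∁ S) ∪ ∁ (∁ R ∪ S)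
    ⨾-assoc  : ∀ R S T → (R ⨾ S) ⨾ T ≡ R ⨾ (S ⨾ T)
    ⨾-distribʳ : ∀ R S T → (R ∪ S) ⨾ T ≡ R ⨾ T ∪ S ⨾ T
    ⨾-identityʳ : ∀ R → R ⨾ I ≡ R
    ᵀ-involutive : ∀ R → (R ᵀ) ᵀ ≡ R
    ᵀ-∪ : ∀ R S → (R ∪ S) ᵀ ≡ R ᵀ ∪ S ᵀ
    ᵀ-⨾ : ∀ R S → (R ⨾ S) ᵀ ≡ S ᵀ ⨾ R ᵀ
    schröder : ∀ R S → R ᵀ ⨾ ∁ (R ⨾ S) ∪ ∁ S ≡ ∁ S

  L : B
  L = I ∪ ∁ I

  O : B
  O = I ∩ ∁ I

  _⁺ : B → B
  R ⁺ = R ⨾ (R *)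

  IsPoint : B → Set ℓ
  IsPoint p = (p ≡ p ⨾ L) × (p ⨾ p ᵀ ⊆ I) × (I ⊆ p ᵀ ⨾ p)

  Univalent : B → Set ℓ
  Univalent R = R ᵀ ⨾ R ⊆ I

  Injective : B → Set ℓ
  Injective R = R ⨾ R ᵀ ⊆ I

  field
    *-unfoldˡ : ∀ R → I ∪ R ⨾ (R *) ⊆ R *
    *-unfoldʳ : ∀ R → I ∪ (R *) ⨾ R ⊆ R *
    *-inductˡ : ∀ R S Q → S ∪ R ⨾ Q ⊆ Q → (R *) ⨾ S ⊆ Q
    *-inductʳ : ∀ R S Q → S ∪ Q ⨾ R ⊆ Q → S ⨾ (R *) ⊆ Q
    tarski : ∀ R → (¬ (R ≡ O)) ⇔ (L ⨾ R ⨾ L ≡ L)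
    point-axiom : ∀ R → ¬ (R ≡ O) →
      Σ B (λ p → Σ B (λ q → IsPoint p × IsPoint q × (p ⨾ q ᵀ ⊆ R)))

-- Read R as a graph and the point p as a vertex.  Then R ⨾ p ≡ O says that no edge enters p, and
-- p ⨾ R ⊆ R ⁺ says that every vertex with a predecessor is reachable from p.  If R is acyclic
-- and p had a predecessor, p would be reachable from itself.  Conversely, injectivity means that
-- every vertex has at most one predecessor, so the predecessor of a vertex on a cycle lies on the
-- cycle too; the vertices off cycles are therefore closed under successors.  The root p lies off
-- every cycle, since it has no predecessor, hence so does everything reachable from p — in
-- particular every vertex with a predecessor, which includes every vertex on a cycle.
module Submission where

open import Defs
open import Level using (Level)
open import Relation.Binary.PropositionalEquality
  using (_≡_; refl; sym; trans; cong; cong₂; subst; isEquivalence; module ≡-Reasoning)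
open import Relation.Binary.Structures using (IsPartialOrder)
open import Relation.Binary.Bundles using (Poset)
open import Algebra.Bundles using (CommutativeSemigroup)
open import Function.Bundles using (_⇔_; mk⇔)
open import Data.Product using (_,_)

module KleeneRelationAlgebraProperties {ℓ : Level} (K : KleeneRelationAlgebra ℓ) where
  open KleeneRelationAlgebra K

  ᵀ-⨾ᵀ : ∀ X Y → (Y ᵀ ⨾ X ᵀ) ᵀ ≡ X ⨾ Y
  ᵀ-⨾ᵀ X Y = trans (ᵀ-⨾ (Y ᵀ) (X ᵀ)) (cong₂ _⨾_ (ᵀ-involutive X) (ᵀ-involutive Y))

  ᵀ-identity : I ᵀ ≡ I
  ᵀ-identity = begin
    I ᵀ              ≡⟨ ⨾-identityʳ (I ᵀ) ⟨
    I ᵀ ⨾ I          ≡⟨ ᵀ-⨾ᵀ (I ᵀ) I ⟨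
    (I ᵀ ⨾ I ᵀ ᵀ) ᵀ  ≡⟨ cong (λ Y → (I ᵀ ⨾ Y) ᵀ) (ᵀ-involutive I) ⟩
    (I ᵀ ⨾ I) ᵀ      ≡⟨ cong _ᵀ (⨾-identityʳ (I ᵀ)) ⟩
    I ᵀ ᵀ            ≡⟨ ᵀ-involutive I ⟩
    I                ∎
    where open ≡-Reasoning

  ⨾-identityˡ : ∀ X → I ⨾ X ≡ X
  ⨾-identityˡ X = begin
    I ⨾ X            ≡⟨ ᵀ-⨾ᵀ I X ⟨
    (X ᵀ ⨾ I ᵀ) ᵀ    ≡⟨ cong (λ Y → (X ᵀ ⨾ Y) ᵀ) ᵀ-identity ⟩
    (X ᵀ ⨾ I) ᵀ      ≡⟨ cong _ᵀ (⨾-identityʳ (X ᵀ)) ⟩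
    X ᵀ ᵀ            ≡⟨ ᵀ-involutive X ⟩
    X                ∎
    where open ≡-Reasoning

  ⨾-distribˡ : ∀ X Y Z → X ⨾ (Y ∪ Z) ≡ X ⨾ Y ∪ X ⨾ Z
  ⨾-distribˡ X Y Z = begin
    X ⨾ (Y ∪ Z)                      ≡⟨ ᵀ-⨾ᵀ X (Y ∪ Z) ⟨
    ((Y ∪ Z) ᵀ ⨾ X ᵀ) ᵀ              ≡⟨ cong (λ W → (W ⨾ X ᵀ) ᵀ) (ᵀ-∪ Y Z) ⟩
    ((Y ᵀ ∪ Z ᵀ) ⨾ X ᵀ) ᵀ            ≡⟨ cong _ᵀ (⨾-distribʳ (Y ᵀ) (Z ᵀ) (X ᵀ)) ⟩
    (Y ᵀ ⨾ X ᵀ ∪ Z ᵀ ⨾ X ᵀ) ᵀ        ≡⟨ ᵀ-∪ (Y ᵀ ⨾ X ᵀ) (Z ᵀ ⨾ X ᵀ) ⟩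
    (Y ᵀ ⨾ X ᵀ) ᵀ ∪ (Z ᵀ ⨾ X ᵀ) ᵀ    ≡⟨ cong₂ _∪_ (ᵀ-⨾ᵀ X Y) (ᵀ-⨾ᵀ X Z) ⟩
    X ⨾ Y ∪ X ⨾ Z                    ∎
    where open ≡-Reasoning

  ∪-commutativeSemigroup : CommutativeSemigroup ℓ ℓ
  ∪-commutativeSemigroup = record
    { _≈_ = _≡_
    ; _∙_ = _∪_
    ; isCommutativeSemigroup = record
      { isSemigroup = record
        { isMagma = record { isEquivalence = isEquivalence ; ∙-cong = cong₂ _∪_ }
        ; assoc = ∪-assoc
        }
      ; comm = ∪-comm
      }
    }

  open import Algebra.Properties.CommutativeSemigroup ∪-commutativeSemigroup using (interchange)

  -- Schröder's axiom with R = I; idempotence of ∪ is not among the axioms.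
  ∁-∪-idem : ∀ X → ∁ X ∪ ∁ X ≡ ∁ X
  ∁-∪-idem X = subst (λ Y → Y ∪ ∁ X ≡ ∁ X) I⨾∁X≡∁X (schröder I X)
    where
    I⨾∁X≡∁X : I ᵀ ⨾ ∁ (I ⨾ X) ≡ ∁ X
    I⨾∁X≡∁X = trans (cong₂ _⨾_ ᵀ-identity (cong ∁ (⨾-identityˡ X))) (⨾-identityˡ (∁ X))

  ∪-idem : ∀ X → X ∪ X ≡ X
  ∪-idem X = begin
    X ∪ X                              ≡⟨ cong₂ _∪_ (huntington X X) (huntington X X) ⟩
    (∁ Y ∪ ∁ Z) ∪ (∁ Y ∪ ∁ Z)          ≡⟨ interchange (∁ Y) (∁ Z) (∁ Y) (∁ Z) ⟩
    (∁ Y ∪ ∁ Y) ∪ (∁ Z ∪ ∁ Z)          ≡⟨ cong₂ _∪_ (∁-∪-idem Y) (∁-∪-idem Z) ⟩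
    ∁ Y ∪ ∁ Z                          ≡⟨ huntington X X ⟨
    X                                  ∎
    where
    open ≡-Reasoning
    Y = ∁ X ∪ ∁ X
    Z = ∁ X ∪ X

  ⊆-reflexive : ∀ {X Y} → X ≡ Y → X ⊆ Y
  ⊆-reflexive {X} refl = ∪-idem X

  ⊆-refl : ∀ {X} → X ⊆ X
  ⊆-refl = ⊆-reflexive refl

  ⊆-trans : ∀ {X Y Z} → X ⊆ Y → Y ⊆ Z → X ⊆ Z
  ⊆-trans {X} {Y} {Z} X⊆Y Y⊆Z = begin
    X ∪ Z          ≡⟨ cong (X ∪_) Y⊆Z ⟨
    X ∪ (Y ∪ Z)    ≡⟨ ∪-assoc X Y Z ⟨
    (X ∪ Y) ∪ Z    ≡⟨ cong (_∪ Z) X⊆Y ⟩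
    Y ∪ Z          ≡⟨ Y⊆Z ⟩
    Z              ∎
    where open ≡-Reasoning

  ⊆-antisym : ∀ {X Y} → X ⊆ Y → Y ⊆ X → X ≡ Y
  ⊆-antisym {X} {Y} X⊆Y Y⊆X = trans (sym Y⊆X) (trans (∪-comm Y X) X⊆Y)

  ⊆-isPartialOrder : IsPartialOrder _≡_ _⊆_
  ⊆-isPartialOrder = record
    { isPreorder = record
      { isEquivalence = isEquivalence
      ; reflexive = ⊆-reflexive
      ; trans = ⊆-trans
      }
    ; antisym = ⊆-antisym
    }

  ⊆-poset : Poset ℓ ℓ ℓ
  ⊆-poset = record { isPartialOrder = ⊆-isPartialOrder }

  open import Relation.Binary.Reasoning.PartialOrder ⊆-poset

  X⊆X∪Y : ∀ {X Y} → X ⊆ X ∪ Y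
  X⊆X∪Y {X} {Y} = trans (sym (∪-assoc X X Y)) (cong (_∪ Y) (∪-idem X))

  Y⊆X∪Y : ∀ {X Y} → Y ⊆ X ∪ Y
  Y⊆X∪Y {X} {Y} = subst (Y ⊆_) (∪-comm Y X) X⊆X∪Y

  ∪-least : ∀ {X Y Z} → X ⊆ Z → Y ⊆ Z → X ∪ Y ⊆ Z
  ∪-least {X} {Y} {Z} X⊆Z Y⊆Z = trans (∪-assoc X Y Z) (trans (cong (X ∪_) Y⊆Z) X⊆Z)

  ⨾-monoʳ : ∀ {X Y Z} → Y ⊆ Z → X ⨾ Y ⊆ X ⨾ Z
  ⨾-monoʳ {X} {Y} {Z} Y⊆Z = trans (sym (⨾-distribˡ X Y Z)) (cong (X ⨾_) Y⊆Z)

  ⨾-monoˡ : ∀ {X Y Z} → X ⊆ Y → X ⨾ Z ⊆ Y ⨾ Z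
  ⨾-monoˡ {X} {Y} {Z} X⊆Y = trans (sym (⨾-distribʳ X Y Z)) (cong (_⨾ Z) X⊆Y)

  ᵀ-mono : ∀ {X Y} → X ⊆ Y → X ᵀ ⊆ Y ᵀ
  ᵀ-mono {X} {Y} X⊆Y = trans (sym (ᵀ-∪ X Y)) (cong _ᵀ X⊆Y)

  ᵀ⊆⇒⊆ᵀ : ∀ {X Y} → X ᵀ ⊆ Y → X ⊆ Y ᵀ
  ᵀ⊆⇒⊆ᵀ {X} {Y} Xᵀ⊆Y = subst (_⊆ Y ᵀ) (ᵀ-involutive X) (ᵀ-mono Xᵀ⊆Y)

  ⊆ᵀ⇒ᵀ⊆ : ∀ {X Y} → X ⊆ Y ᵀ → X ᵀ ⊆ Y
  ⊆ᵀ⇒ᵀ⊆ {X} {Y} X⊆Yᵀ = subst (X ᵀ ⊆_) (ᵀ-involutive Y) (ᵀ-mono X⊆Yᵀ)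

  ∁-∪⊆ : ∀ X Y → ∁ (∁ X ∪ Y) ⊆ X
  ∁-∪⊆ X Y = subst (∁ (∁ X ∪ Y) ⊆_) (sym (huntington X Y)) Y⊆X∪Y

  ∁∁⊆ : ∀ X → ∁ (∁ X) ⊆ X
  ∁∁⊆ X = subst (λ Y → ∁ Y ⊆ X) (∪-idem (∁ X)) (∁-∪⊆ X (∁ X))

  ∁-involutive : ∀ X → ∁ (∁ X) ≡ X
  ∁-involutive X = ⊆-antisym (∁∁⊆ X) (begin
    X                                    ≡⟨ huntington X X ⟩
    ∁ (∁ X ∪ ∁ X) ∪ ∁ (∁ X ∪ X)          ≡⟨ cong (λ Y → ∁ Y ∪ ∁ (∁ X ∪ X)) (∪-idem (∁ X)) ⟩
    ∁ (∁ X) ∪ ∁ (∁ X ∪ X)                ≤⟨ ∪-least ⊆-refl ∁-∪-self⊆∁∁ ⟩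
    ∁ (∁ X)                              ∎)
    where
    ∁-∪-self⊆∁∁ : ∁ (∁ X ∪ X) ⊆ ∁ (∁ X)
    ∁-∪-self⊆∁∁ = subst (λ Y → ∁ Y ⊆ ∁ (∁ X))
      (trans (sym (∪-assoc _ (∁ X) X)) (cong (_∪ X) (∁∁⊆ (∁ X))))
      (∁-∪⊆ (∁ (∁ X)) (∁ X ∪ X))

  ∁-antitone : ∀ {X Y} → X ⊆ Y → ∁ Y ⊆ ∁ X
  ∁-antitone {X} {Y} X⊆Y =
    subst (λ Z → ∁ Z ⊆ ∁ X) (trans (cong (_∪ Y) (∁-involutive X)) X⊆Y) (∁-∪⊆ (∁ X) Y)

  ⊆-∪-∁ : ∀ X Y → X ⊆ Y ∪ ∁ Y
  ⊆-∪-∁ X Y = subst (_⊆ Y ∪ ∁ Y) (sym (huntington X Y)) (∪-least ∁-∪-∁⊆Y ∁-∪⊆∁Y)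
    where
    ∁-∪-∁⊆Y : ∁ (∁ X ∪ ∁ Y) ⊆ Y ∪ ∁ Y
    ∁-∪-∁⊆Y = ⊆-trans (∁-antitone Y⊆X∪Y) (subst (_⊆ Y ∪ ∁ Y) (sym (∁-involutive Y)) X⊆X∪Y)
    ∁-∪⊆∁Y : ∁ (∁ X ∪ Y) ⊆ Y ∪ ∁ Y
    ∁-∪⊆∁Y = ⊆-trans (∁-antitone Y⊆X∪Y) Y⊆X∪Y

  ⊆-L : ∀ {X} → X ⊆ L
  ⊆-L {X} = ⊆-∪-∁ X I

  ∩-lowerˡ : ∀ {X Y} → X ∩ Y ⊆ X
  ∩-lowerˡ {X} {Y} = subst (X ∩ Y ⊆_) (∁-involutive X) (∁-antitone X⊆X∪Y)

  ∩-lowerʳ : ∀ {X Y} → X ∩ Y ⊆ Y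
  ∩-lowerʳ {X} {Y} = subst (X ∩ Y ⊆_) (∁-involutive Y) (∁-antitone Y⊆X∪Y)

  ∩-greatest : ∀ {X Y Z} → X ⊆ Y → X ⊆ Z → X ⊆ Y ∩ Z
  ∩-greatest {X} X⊆Y X⊆Z =
    subst (_⊆ _) (∁-involutive X) (∁-antitone (∪-least (∁-antitone X⊆Y) (∁-antitone X⊆Z)))

  ∩-comm : ∀ X Y → X ∩ Y ≡ Y ∩ X
  ∩-comm X Y = cong ∁ (∪-comm (∁ X) (∁ Y))

  ∩-complementʳ : ∀ X {Y} → X ∩ ∁ X ⊆ Y
  ∩-complementʳ X {Y} =
    subst (_ ⊆_) (∁-involutive Y) (∁-antitone (⊆-∪-∁ (∁ Y) (∁ X)))

  O-⊆ : ∀ {X} → O ⊆ X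
  O-⊆ = ∩-complementʳ I

  ⊆∧⊆∁⇒⊆O : ∀ {X Y} → X ⊆ Y → X ⊆ ∁ Y → X ⊆ O
  ⊆∧⊆∁⇒⊆O {Y = Y} X⊆Y X⊆∁Y = ⊆-trans (∩-greatest X⊆Y X⊆∁Y) (∩-complementʳ Y)

  ∩⊆O⇒⊆∁ : ∀ {X Y} → X ∩ Y ⊆ O → X ⊆ ∁ Y
  ∩⊆O⇒⊆∁ {X} {Y} X∩Y⊆O =
    subst (_⊆ ∁ Y) (sym (huntington X (∁ Y))) (∪-least ∩-lowerʳ (⊆-trans X∩Y⊆O O-⊆))

  ∁-∪ : ∀ X Y → ∁ (X ∪ Y) ≡ ∁ X ∩ ∁ Y
  ∁-∪ X Y = cong ∁ (sym (cong₂ _∪_ (∁-involutive X) (∁-involutive Y)))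

  ⊆∪-elimˡ : ∀ {X Y Z} → X ⊆ Y ∪ Z → X ⊆ ∁ Y → X ⊆ Z
  ⊆∪-elimˡ {X} {Y} {Z} X⊆Y∪Z X⊆∁Y = subst (X ⊆_) (∁-involutive Z) (∩⊆O⇒⊆∁ (begin
    X ∩ ∁ Z                  ≤⟨ ∩-greatest (⊆-trans ∩-lowerˡ X⊆Y∪Z)
                                   (∩-greatest (⊆-trans ∩-lowerˡ X⊆∁Y) ∩-lowerʳ) ⟩
    (Y ∪ Z) ∩ (∁ Y ∩ ∁ Z)    ≡⟨ cong ((Y ∪ Z) ∩_) (∁-∪ Y Z) ⟨
    (Y ∪ Z) ∩ ∁ (Y ∪ Z)      ≤⟨ ∩-complementʳ (Y ∪ Z) ⟩
    O                        ∎))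

  ∁ᵀ⊆ᵀ∁ : ∀ X → ∁ (X ᵀ) ⊆ (∁ X) ᵀ
  ∁ᵀ⊆ᵀ∁ X = ⊆∪-elimˡ (⊆-trans ⊆-L L⊆Xᵀ∪∁Xᵀ) ⊆-refl
    where
    L⊆Xᵀ∪∁Xᵀ : L ⊆ X ᵀ ∪ (∁ X) ᵀ
    L⊆Xᵀ∪∁Xᵀ = subst (L ⊆_) (ᵀ-∪ X (∁ X)) (ᵀ⊆⇒⊆ᵀ (⊆-∪-∁ (L ᵀ) X))

  ᵀ-∁ : ∀ X → (∁ X) ᵀ ≡ ∁ (X ᵀ)
  ᵀ-∁ X = ⊆-antisym (⊆ᵀ⇒ᵀ⊆ (subst (λ Y → ∁ Y ⊆ (∁ (X ᵀ)) ᵀ) (ᵀ-involutive X) (∁ᵀ⊆ᵀ∁ (X ᵀ)))) (∁ᵀ⊆ᵀ∁ X)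

  schröderˡ : ∀ {X Y Z} → X ⨾ Y ⊆ Z → X ᵀ ⨾ ∁ Z ⊆ ∁ Y
  schröderˡ {X} {Y} X⨾Y⊆Z = ⊆-trans (⨾-monoʳ (∁-antitone X⨾Y⊆Z)) (schröder X Y)

  schröderʳ : ∀ {X Y Z} → X ⨾ Y ⊆ Z → ∁ Z ⨾ Y ᵀ ⊆ ∁ X
  schröderʳ {X} {Y} {Z} X⨾Y⊆Z = begin
    ∁ Z ⨾ Y ᵀ                  ≡⟨ cong (_⨾ Y ᵀ) (trans (sym (ᵀ-involutive (∁ Z))) (cong _ᵀ (ᵀ-∁ Z))) ⟩
    (∁ (Z ᵀ)) ᵀ ⨾ Y ᵀ          ≡⟨ ᵀ-⨾ Y (∁ (Z ᵀ)) ⟨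
    (Y ⨾ ∁ (Z ᵀ)) ᵀ            ≤⟨ ᵀ-mono Y⨾∁Zᵀ⊆∁Xᵀ ⟩
    (∁ (X ᵀ)) ᵀ                ≡⟨ cong _ᵀ (ᵀ-∁ X) ⟨
    (∁ X) ᵀ ᵀ                  ≡⟨ ᵀ-involutive (∁ X) ⟩
    ∁ X                        ∎
    where
    Y⨾∁Zᵀ⊆∁Xᵀ : Y ⨾ ∁ (Z ᵀ) ⊆ ∁ (X ᵀ)
    Y⨾∁Zᵀ⊆∁Xᵀ = subst (λ W → W ⨾ ∁ (Z ᵀ) ⊆ ∁ (X ᵀ)) (ᵀ-involutive Y)
      (schröderˡ (subst (_⊆ Z ᵀ) (ᵀ-⨾ X Y) (ᵀ-mono X⨾Y⊆Z)))

  ⨾-zeroʳ : ∀ X → X ⨾ O ≡ O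
  ⨾-zeroʳ X = ⊆-antisym (begin
    X ⨾ O              ≤⟨ ⨾-monoʳ O-⊆ ⟩
    X ⨾ ∁ L            ≡⟨ cong (_⨾ ∁ L) (ᵀ-involutive X) ⟨
    X ᵀ ᵀ ⨾ ∁ L        ≤⟨ schröderˡ ⊆-L ⟩
    ∁ L                ≤⟨ ∁-antitone ⊆-L ⟩
    ∁ (∁ O)            ≡⟨ ∁-involutive O ⟩
    O                  ∎) O-⊆

  ⨾-zeroˡ : ∀ X → O ⨾ X ≡ O
  ⨾-zeroˡ X = ⊆-antisym (begin
    O ⨾ X              ≡⟨ ᵀ-⨾ᵀ O X ⟨
    (X ᵀ ⨾ O ᵀ) ᵀ      ≤⟨ ᵀ-mono (⨾-monoʳ (⊆ᵀ⇒ᵀ⊆ O-⊆)) ⟩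
    (X ᵀ ⨾ O) ᵀ        ≡⟨ cong _ᵀ (⨾-zeroʳ (X ᵀ)) ⟩
    O ᵀ                ≤⟨ ⊆ᵀ⇒ᵀ⊆ O-⊆ ⟩
    O                  ∎) O-⊆

  dedekind : ∀ Q S T → (Q ⨾ S) ∩ T ⊆ Q ⨾ (S ∩ (Q ᵀ ⨾ T))
  dedekind Q S T = ⊆∪-elimˡ (⊆-trans ∩-lowerˡ Q⨾S⊆) (⊆-trans ∩-lowerʳ T⊆∁)
    where
    U = Q ᵀ ⨾ T
    Q⨾S⊆ : Q ⨾ S ⊆ Q ⨾ (S ∩ ∁ U) ∪ Q ⨾ (S ∩ U)
    Q⨾S⊆ = ⊆-reflexive (trans (cong (Q ⨾_) (huntington S (∁ U))) (⨾-distribˡ Q _ _))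
    T⊆∁ : T ⊆ ∁ (Q ⨾ (S ∩ ∁ U))
    T⊆∁ = subst (_⊆ ∁ (Q ⨾ (S ∩ ∁ U))) (∁-involutive T) (∁-antitone (begin
      Q ⨾ (S ∩ ∁ U)          ≤⟨ ⨾-monoʳ ∩-lowerʳ ⟩
      Q ⨾ ∁ (Q ᵀ ⨾ T)        ≡⟨ cong (_⨾ ∁ U) (ᵀ-involutive Q) ⟨
      Q ᵀ ᵀ ⨾ ∁ (Q ᵀ ⨾ T)    ≤⟨ schröderˡ ⊆-refl ⟩
      ∁ T                    ∎))

  X⊆L⨾X : ∀ {X} → X ⊆ L ⨾ X
  X⊆L⨾X {X} = subst (_⊆ L ⨾ X) (⨾-identityˡ X) (⨾-monoˡ ⊆-L)

  R⁺⊆R* : ∀ R → R ⁺ ⊆ R *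
  R⁺⊆R* R = ⊆-trans Y⊆X∪Y (*-unfoldˡ R)

  R⁺⊆R*⨾R : ∀ R → R ⁺ ⊆ R * ⨾ R
  R⁺⊆R*⨾R R = *-inductʳ R R (R * ⨾ R) (∪-least R⊆R*⨾R (⨾-monoˡ R*⨾R⊆R*))
    where
    R⊆R*⨾R : R ⊆ R * ⨾ R
    R⊆R*⨾R = subst (_⊆ R * ⨾ R) (⨾-identityˡ R) (⨾-monoˡ (⊆-trans X⊆X∪Y (*-unfoldˡ R)))
    R*⨾R⊆R* : R * ⨾ R ⊆ R *
    R*⨾R⊆R* = ⊆-trans Y⊆X∪Y (*-unfoldʳ R)

  point-conjugate⊆I : ∀ {p} → IsPoint p → ∀ X → p ⨾ X ⨾ p ᵀ ⊆ I
  point-conjugate⊆I {p} (p≡p⨾L , p⨾pᵀ⊆I , _) X = begin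
    p ⨾ X ⨾ p ᵀ        ≤⟨ ⨾-monoʳ (⨾-monoˡ ⊆-L) ⟩
    p ⨾ L ⨾ p ᵀ        ≡⟨ ⨾-assoc p L (p ᵀ) ⟨
    (p ⨾ L) ⨾ p ᵀ      ≡⟨ cong (_⨾ p ᵀ) p≡p⨾L ⟨
    p ⨾ p ᵀ            ≤⟨ p⨾pᵀ⊆I ⟩
    I                  ∎

  point-conjugate⊆O⇒⊆O : ∀ {p} → IsPoint p → ∀ {X} → p ⨾ X ⨾ p ᵀ ⊆ O → X ⊆ O
  point-conjugate⊆O⇒⊆O {p} (_ , _ , I⊆pᵀ⨾p) {X} p⨾X⨾pᵀ⊆O = begin
    X                          ≡⟨ trans (⨾-identityˡ _) (⨾-identityʳ X) ⟨
    I ⨾ X ⨾ I                  ≤⟨ ⨾-monoˡ I⊆pᵀ⨾p ⟩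
    (p ᵀ ⨾ p) ⨾ X ⨾ I          ≤⟨ ⨾-monoʳ (⨾-monoʳ I⊆pᵀ⨾p) ⟩
    (p ᵀ ⨾ p) ⨾ X ⨾ p ᵀ ⨾ p    ≡⟨ regroup ⟩
    p ᵀ ⨾ (p ⨾ X ⨾ p ᵀ) ⨾ p    ≤⟨ ⨾-monoʳ (⨾-monoˡ p⨾X⨾pᵀ⊆O) ⟩
    p ᵀ ⨾ O ⨾ p                ≡⟨ trans (cong (p ᵀ ⨾_) (⨾-zeroˡ p)) (⨾-zeroʳ (p ᵀ)) ⟩
    O                          ∎
    where
    regroup : (p ᵀ ⨾ p) ⨾ X ⨾ p ᵀ ⨾ p ≡ p ᵀ ⨾ (p ⨾ X ⨾ p ᵀ) ⨾ p
    regroup = trans (⨾-assoc (p ᵀ) p _) (cong (p ᵀ ⨾_) (trans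
      (cong (p ⨾_) (sym (⨾-assoc X (p ᵀ) p))) (sym (⨾-assoc p (X ⨾ p ᵀ) p))))

  point-L⨾⊆ : ∀ {p} → IsPoint p → ∀ X → L ⨾ X ⊆ p ᵀ ⨾ p ⨾ X
  point-L⨾⊆ {p} (p≡p⨾L , _ , I⊆pᵀ⨾p) X = begin
    L ⨾ X                  ≡⟨ cong (_⨾ X) (⨾-identityˡ L) ⟨
    (I ⨾ L) ⨾ X            ≤⟨ ⨾-monoˡ (⨾-monoˡ I⊆pᵀ⨾p) ⟩
    ((p ᵀ ⨾ p) ⨾ L) ⨾ X    ≡⟨ cong (_⨾ X) (⨾-assoc (p ᵀ) p L) ⟩
    (p ᵀ ⨾ p ⨾ L) ⨾ X      ≡⟨ cong (λ Y → (p ᵀ ⨾ Y) ⨾ X) p≡p⨾L ⟨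
    (p ᵀ ⨾ p) ⨾ X          ≡⟨ ⨾-assoc (p ᵀ) p X ⟩
    p ᵀ ⨾ p ⨾ X            ∎

  no-predecessor : ∀ {R X} → R ⨾ X ⊆ O → X ᵀ ⊆ ∁ (L ⨾ R)
  no-predecessor {R} {X} R⨾X⊆O = begin
    X ᵀ                ≤⟨ X⊆L⨾X ⟩
    L ⨾ X ᵀ            ≤⟨ ⨾-monoˡ (∩⊆O⇒⊆∁ ∩-lowerʳ) ⟩
    ∁ O ⨾ X ᵀ          ≤⟨ schröderʳ L⨾R⨾X⊆O ⟩
    ∁ (L ⨾ R)          ∎
    where
    L⨾R⨾X⊆O : (L ⨾ R) ⨾ X ⊆ O
    L⨾R⨾X⊆O = begin
      (L ⨾ R) ⨾ X      ≡⟨ ⨾-assoc L R X ⟩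
      L ⨾ R ⨾ X        ≤⟨ ⨾-monoʳ R⨾X⊆O ⟩
      L ⨾ O            ≡⟨ ⨾-zeroʳ L ⟩
      O                ∎

  -- cyclic R is the partial identity on the vertices lying on a cycle, and L ⨾ cyclic R the
  -- corresponding row vector.
  cyclic : B → B
  cyclic R = (R ⁺) ∩ I

  cyclic⨾ᵀ⊆ᵀ⨾cyclic : ∀ {R} → Injective R → cyclic R ⨾ R ᵀ ⊆ R ᵀ ⨾ cyclic R
  cyclic⨾ᵀ⊆ᵀ⨾cyclic {R} injective = begin
    cyclic R ⨾ R ᵀ                  ≤⟨ ∩-greatest ⊆Rᵀ⨾I ⊆R* ⟩
    (R ᵀ ⨾ I) ∩ (R *)               ≤⟨ dedekind (R ᵀ) I (R *) ⟩
    R ᵀ ⨾ (I ∩ (R ᵀ ᵀ ⨾ R *))       ≡⟨ cong (λ Y → R ᵀ ⨾ (I ∩ (Y ⨾ R *))) (ᵀ-involutive R) ⟩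
    R ᵀ ⨾ (I ∩ (R ⁺))                ≡⟨ cong (R ᵀ ⨾_) (∩-comm I (R ⁺)) ⟩
    R ᵀ ⨾ cyclic R                  ∎
    where
    ⊆Rᵀ⨾I : cyclic R ⨾ R ᵀ ⊆ R ᵀ ⨾ I
    ⊆Rᵀ⨾I = begin
      cyclic R ⨾ R ᵀ   ≤⟨ ⨾-monoˡ ∩-lowerʳ ⟩
      I ⨾ R ᵀ          ≡⟨ trans (⨾-identityˡ (R ᵀ)) (sym (⨾-identityʳ (R ᵀ))) ⟩
      R ᵀ ⨾ I          ∎
    ⊆R* : cyclic R ⨾ R ᵀ ⊆ R *
    ⊆R* = begin
      cyclic R ⨾ R ᵀ       ≤⟨ ⨾-monoˡ (⊆-trans ∩-lowerˡ (R⁺⊆R*⨾R R)) ⟩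
      (R * ⨾ R) ⨾ R ᵀ      ≡⟨ ⨾-assoc (R *) R (R ᵀ) ⟩
      R * ⨾ R ⨾ R ᵀ        ≤⟨ ⨾-monoʳ injective ⟩
      R * ⨾ I              ≡⟨ ⨾-identityʳ (R *) ⟩
      R *                  ∎

  ∁-cyclic-closed : ∀ {R} → Injective R → ∁ (L ⨾ cyclic R) ⨾ R ⊆ ∁ (L ⨾ cyclic R)
  ∁-cyclic-closed {R} injective =
    subst (λ Y → ∁ (L ⨾ cyclic R) ⨾ Y ⊆ ∁ (L ⨾ cyclic R)) (ᵀ-involutive R) (schröderʳ (begin
      (L ⨾ cyclic R) ⨾ R ᵀ    ≡⟨ ⨾-assoc L (cyclic R) (R ᵀ) ⟩
      L ⨾ cyclic R ⨾ R ᵀ      ≤⟨ ⨾-monoʳ (cyclic⨾ᵀ⊆ᵀ⨾cyclic injective) ⟩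
      L ⨾ R ᵀ ⨾ cyclic R      ≡⟨ ⨾-assoc L (R ᵀ) (cyclic R) ⟨
      (L ⨾ R ᵀ) ⨾ cyclic R    ≤⟨ ⨾-monoˡ ⊆-L ⟩
      L ⨾ cyclic R            ∎))

  L⨾cyclic⊆L⨾R : ∀ R → L ⨾ cyclic R ⊆ L ⨾ R
  L⨾cyclic⊆L⨾R R = begin
    L ⨾ cyclic R       ≤⟨ ⨾-monoʳ (⊆-trans ∩-lowerˡ (R⁺⊆R*⨾R R)) ⟩
    L ⨾ R * ⨾ R        ≡⟨ ⨾-assoc L (R *) R ⟨
    (L ⨾ R *) ⨾ R      ≤⟨ ⨾-monoˡ ⊆-L ⟩
    L ⨾ R              ∎

  acyclic⇒no-predecessor : ∀ {R p} → IsPoint p → p ⨾ R ⊆ R ⁺ → R ⁺ ⊆ ∁ I → R ⨾ p ≡ O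
  acyclic⇒no-predecessor {R} {p} isPoint@(_ , p⨾pᵀ⊆I , _) p⨾R⊆R⁺ acyclic =
    ⊆-antisym (point-conjugate⊆O⇒⊆O isPoint (⊆∧⊆∁⇒⊆O (point-conjugate⊆I isPoint (R ⨾ p)) (begin
      p ⨾ (R ⨾ p) ⨾ p ᵀ      ≡⟨ cong (p ⨾_) (⨾-assoc R p (p ᵀ)) ⟩
      p ⨾ R ⨾ p ⨾ p ᵀ        ≤⟨ ⨾-monoʳ (⨾-monoʳ p⨾pᵀ⊆I) ⟩
      p ⨾ R ⨾ I              ≡⟨ cong (p ⨾_) (⨾-identityʳ R) ⟩
      p ⨾ R                  ≤⟨ p⨾R⊆R⁺ ⟩
      R ⁺                    ≤⟨ acyclic ⟩
      ∁ I                    ∎))) O-⊆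

  no-predecessor⇒acyclic : ∀ {R p} → Injective R → IsPoint p → p ⨾ R ⊆ R ⁺ → R ⨾ p ≡ O →
                           R ⁺ ⊆ ∁ I
  no-predecessor⇒acyclic {R} {p} injective isPoint p⨾R⊆R⁺ R⨾p≡O =
    ∩⊆O⇒⊆∁ (⊆-trans X⊆L⨾X (⊆∧⊆∁⇒⊆O ⊆-refl (⊆-trans (L⨾cyclic⊆L⨾R R) L⨾R⊆∁C)))
    where
    C = L ⨾ cyclic R
    reachable⊆∁C : p ᵀ ⨾ R * ⊆ ∁ C
    reachable⊆∁C = *-inductʳ R (p ᵀ) (∁ C) (∪-least
      (⊆-trans (no-predecessor (⊆-reflexive R⨾p≡O)) (∁-antitone (L⨾cyclic⊆L⨾R R)))
      (∁-cyclic-closed injective))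
    L⨾R⊆∁C : L ⨾ R ⊆ ∁ C
    L⨾R⊆∁C = begin
      L ⨾ R              ≤⟨ point-L⨾⊆ isPoint R ⟩
      p ᵀ ⨾ p ⨾ R        ≤⟨ ⨾-monoʳ p⨾R⊆R⁺ ⟩
      p ᵀ ⨾ R ⁺          ≤⟨ ⨾-monoʳ (R⁺⊆R* R) ⟩
      p ᵀ ⨾ R *          ≤⟨ reachable⊆∁C ⟩
      ∁ C                ∎

mainTheorem17 : ∀ {ℓ : Level} (K : KleeneRelationAlgebra ℓ) →
    let open KleeneRelationAlgebra K in
    ∀ (R p : B) → Injective R → Univalent R → IsPoint p → p ⨾ R ⊆ R ⁺ →
    ((R ⨾ p ≡ O) ⇔ (R ⁺ ⊆ ∁ I))
mainTheorem17 K R p injective _ isPoint p⨾R⊆R⁺ =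
  mk⇔ (no-predecessor⇒acyclic injective isPoint p⨾R⊆R⁺) (acyclic⇒no-predecessor isPoint p⨾R⊆R⁺)
  where open KleeneRelationAlgebraProperties K
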